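{- Let $\overline{\alpha} = (\alpha_1, \alpha_2, \dots)$ with each $\alpha_i \in [0, \infty]$, and for $s \geq 2$ write $\overline{\alpha}\cdot v_s = \sum_{i=1}^{s-1} \alpha_i \binom{s}{i+1}$ (with $0\cdot \infty = 0$). Then for any $s \geq 2$, if $s - \overline{\alpha}\cdot v_s < 1$ then $s + 1 - \overline{\alpha}\cdot v_{s+1} < 0$; and for any $s \geq 3$, if $s - \overline{\alpha}\cdot v_s > 1$ then $s - 1 - \overline{\alpha}\cdot v_{s-1} > 1$.
   Context: For $s\ge 1$, $v_s$ denotes the vector of binomial coefficients $\left(\binom{s}{i+1}\right)_{i \geq 1}$, and $\overline{\alpha}\cdot v_s = \sum_{i\ge 1}\alpha_i\binom{s}{i+1}$. -}

module Defs where

import Level as L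
open import Algebra.Bundles using (CommutativeRing)
open import Relation.Binary.Core using (Rel)
open import Relation.Binary.Structures using (IsStrictTotalOrder)
open import Relation.Nullary using (¬_)
open import Data.Product using (∃; _×_)
open import Data.Sum using (_⊎_)
open import Data.Unit.Polymorphic using (⊤)
open import Data.Empty.Polymorphic using (⊥)
open import Data.Nat using (ℕ; zero; suc; _∸_)
open import Data.Nat.Combinatorics using (_C_)

record OrderedField c ℓ₁ ℓ₂ : Set (L.suc (c L.⊔ ℓ₁ L.⊔ ℓ₂)) where
  field
    commutativeRing : CommutativeRing c ℓ₁
  open CommutativeRing commutativeRing public
  infix 4 _<_
  field
    _<_                 : Rel Carrier ℓ₂
    <-isStrictTotalOrder : IsStrictTotalOrder _≈_ _<_
    0<1                 : 0# < 1#
    +-mono-<            : ∀ {a b} c → a < b → (a + c) < (b + c)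
    *-pos               : ∀ {a b} → 0# < a → 0# < b → 0# < (a * b)
    inverse             : ∀ x → ¬ (x ≈ 0#) → ∃ λ y → (x * y) ≈ 1#

module WithField {c ℓ₁ ℓ₂} (F : OrderedField c ℓ₁ ℓ₂) where
  open OrderedField F public

  fromℕ : ℕ → Carrier
  fromℕ zero    = 0#
  fromℕ (suc n) = 1# + fromℕ n

  -- extended values  F ∪ {∞}  (used for [0,∞])
  data Ext : Set c where
    fin : Carrier → Ext
    ∞   : Ext

  NonNeg : Ext → Set (ℓ₁ L.⊔ ℓ₂)
  NonNeg (fin x) = (0# < x) ⊎ (0# ≈ x)
  NonNeg ∞       = ⊤

  _⊕_ : Ext → Ext → Ext
  fin a ⊕ fin b = fin (a + b)
  fin a ⊕ ∞     = ∞
  ∞     ⊕ _     = ∞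

  _·_ : ℕ → Ext → Ext
  n     · fin x = fin (fromℕ n * x)
  zero  · ∞     = fin 0#
  suc n · ∞     = ∞

  -- dotAux α s k = Σ_{i=1}^{k} α_i · C(s, i+1)     (α 0 is unused)
  dotAux : (ℕ → Ext) → ℕ → ℕ → Ext
  dotAux α s zero    = fin 0#
  dotAux α s (suc k) = dotAux α s k ⊕ ((s C suc (suc k)) · α (suc k))

  dot : (ℕ → Ext) → ℕ → Ext
  dot α s = dotAux α s (s ∸ 1)

  -- "c - A < d" for A ∈ F ∪ {∞}  (c - ∞ = -∞ < d)
  _−_<ₑ_ : Carrier → Ext → Carrier → Set ℓ₂
  x − fin a <ₑ d = (x - a) < d
  x − ∞     <ₑ d = ⊤

  -- "c - A > d" for A ∈ F ∪ {∞}  (c - ∞ = -∞ is never > d)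
  _−_>ₑ_ : Carrier → Ext → Carrier → Set ℓ₂
  x − fin a >ₑ d = d < (x - a)
  x − ∞     >ₑ d = ⊥

{-# OPTIONS --safe #-}
-- Since s · C(s-1, k) = (s-k) · C(s, k), each coefficient satisfies s · C(s-1, k) ≤ (s-2) · C(s, k)
-- for k ≥ 2; summing against the nonnegative α_i (ᾱ·v_s has one extra nonnegative term) gives
-- s · (ᾱ·v_{s-1}) ≤ (s-2) · (ᾱ·v_s). So ᾱ·v_{s-1} > s-2 forces ᾱ·v_s > s, and
-- ᾱ·v_s < s-1 forces ᾱ·v_{s-1} < s-2.
module Submission where

open import Defs
open import Data.Nat using (ℕ; zero; suc; _∸_)
import Data.Nat as ℕ
import Data.Nat.Properties as ℕₚ
open import Data.Nat.Combinatorics using (_C_; nC1≡n; nCk+nC[k+1]≡[n+1]C[k+1])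
open import Data.Nat.Tactic.RingSolver using (solve-∀)
open import Data.Product using (_×_; _,_)
open import Level using (_⊔_)
open import Data.Sum using (inj₁; inj₂)
open import Data.Unit.Polymorphic using (tt)
open import Relation.Nullary using (contradiction)
open import Relation.Binary.Bundles using (StrictPartialOrder)
open import Relation.Binary.Definitions using (tri<; tri≈; tri>)
open import Relation.Binary.Structures using (IsStrictTotalOrder)
open import Relation.Binary.PropositionalEquality as ≡ using (_≡_; cong; cong₂)
import Relation.Binary.Construct.StrictToNonStrict as StrictToNonStrict
import Relation.Binary.Reasoning.StrictPartialOrder as StrictReasoning
import Algebra.Properties.Group as GroupProperties

module _ where
  open import Data.Nat using (_+_; _*_; _≤_; z≤n; s≤s)
  open ℕₚ using (*-zeroʳ; *-identityˡ; *-identityʳ; *-distribˡ-+; *-distribʳ-+; +-comm; +-identityʳ)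

  [1+k]*[1+n]C[1+k]≡[1+n]*nCk : ∀ n k → suc k * (suc n C suc k) ≡ suc n * (n C k)
  [1+k]*[1+n]C[1+k]≡[1+n]*nCk zero    zero    = ≡.refl
  [1+k]*[1+n]C[1+k]≡[1+n]*nCk zero    (suc k) = *-zeroʳ (suc (suc k))
  [1+k]*[1+n]C[1+k]≡[1+n]*nCk (suc n) zero    =
    ≡.trans (*-identityˡ _) (≡.trans (nC1≡n (suc (suc n))) (≡.sym (*-identityʳ _)))
  [1+k]*[1+n]C[1+k]≡[1+n]*nCk (suc n) (suc k) = begin
    suc (suc k) * (suc (suc n) C suc (suc k))
      ≡⟨ cong (suc (suc k) *_) (nCk+nC[k+1]≡[n+1]C[k+1] (suc n) (suc k)) ⟨
    suc (suc k) * (x + y)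
      ≡⟨ regroup x y ⟩
    x + (suc k * x + suc (suc k) * y)
      ≡⟨ cong₂ (λ u v → x + (u + v)) ([1+k]*[1+n]C[1+k]≡[1+n]*nCk n k)
                                     ([1+k]*[1+n]C[1+k]≡[1+n]*nCk n (suc k)) ⟩
    x + (suc n * (n C k) + suc n * (n C suc k))
      ≡⟨ cong (x +_) (*-distribˡ-+ (suc n) (n C k) (n C suc k)) ⟨
    x + suc n * (n C k + n C suc k)
      ≡⟨ cong (λ z → x + suc n * z) (nCk+nC[k+1]≡[n+1]C[k+1] n k) ⟩
    suc (suc n) * x ∎
    where
    open ≡.≡-Reasoning
    x = suc n C suc k
    y = suc n C suc (suc k)
    regroup : ∀ u v → suc (suc k) * (u + v) ≡ u + (suc k * u + suc (suc k) * v)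
    regroup = solve-∀

  [1+n]*[1+n]Ck≡[1+n]*nCk+k*[1+n]Ck : ∀ n k → suc n * (suc n C k) ≡ suc n * (n C k) + k * (suc n C k)
  [1+n]*[1+n]Ck≡[1+n]*nCk+k*[1+n]Ck n zero    = ≡.sym (+-identityʳ _)
  [1+n]*[1+n]Ck≡[1+n]*nCk+k*[1+n]Ck n (suc k) = begin
    suc n * (suc n C suc k)                          ≡⟨ cong (suc n *_) (nCk+nC[k+1]≡[n+1]C[k+1] n k) ⟨
    suc n * (n C k + n C suc k)                      ≡⟨ *-distribˡ-+ (suc n) (n C k) (n C suc k) ⟩
    suc n * (n C k) + suc n * (n C suc k)            ≡⟨ cong (_+ suc n * (n C suc k)) ([1+k]*[1+n]C[1+k]≡[1+n]*nCk n k) ⟨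
    suc k * (suc n C suc k) + suc n * (n C suc k)    ≡⟨ +-comm (suc k * (suc n C suc k)) (suc n * (n C suc k)) ⟩
    suc n * (n C suc k) + suc k * (suc n C suc k)    ∎
    where open ≡.≡-Reasoning

  [2+t]*[1+t]C[2+j]≤t*[2+t]C[2+j] : ∀ t j → suc (suc t) * (suc t C (2 + j)) ≤ t * (suc (suc t) C (2 + j))
  [2+t]*[1+t]C[2+j]≤t*[2+t]C[2+j] t j = ℕₚ.+-cancelʳ-≤ (k * X) _ _ (begin
    suc (suc t) * (suc t C k) + k * X  ≡⟨ [1+n]*[1+n]Ck≡[1+n]*nCk+k*[1+n]Ck (suc t) k ⟨
    suc (suc t) * X                    ≡⟨ split X ⟩
    t * X + 2 * X                      ≤⟨ ℕₚ.+-monoʳ-≤ (t * X) (ℕₚ.*-monoˡ-≤ X {2} {k} (s≤s (s≤s z≤n))) ⟩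
    t * X + k * X                      ∎)
    where
    open ℕₚ.≤-Reasoning
    k = 2 + j
    X = suc (suc t) C k
    split : ∀ x → suc (suc t) * x ≡ t * x + 2 * x
    split x = ≡.trans (*-distribʳ-+ x 2 t) (+-comm (2 * x) (t * x))

module _ {c ℓ₁ ℓ₂} (F : OrderedField c ℓ₁ ℓ₂) where
  open WithField F
  open IsStrictTotalOrder <-isStrictTotalOrder
    using (isStrictPartialOrder; compare; irrefl; <-respʳ-≈; <-respˡ-≈) renaming (trans to <-trans)
  open GroupProperties +-group using (//-rightDividesˡ; //-rightDividesʳ)
  open StrictToNonStrict _≈_ _<_ using (_≤_; <⇒≤) renaming (reflexive to ≈⇒≤)

  strictPartialOrder : StrictPartialOrder c ℓ₁ ℓ₂
  strictPartialOrder = record { isStrictPartialOrder = isStrictPartialOrder }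

  open StrictReasoning strictPartialOrder

  +-monoʳ-< : ∀ c {a b} → a < b → c + a < c + b
  +-monoʳ-< c {a} {b} a<b = begin-strict
    c + a  ≈⟨ +-comm c a ⟩
    a + c  <⟨ +-mono-< c a<b ⟩
    b + c  ≈⟨ +-comm b c ⟩
    c + b  ∎

  +-monoˡ-≤ : ∀ c {a b} → a ≤ b → a + c ≤ b + c
  +-monoˡ-≤ c (inj₁ a<b) = <⇒≤ (+-mono-< c a<b)
  +-monoˡ-≤ c (inj₂ a≈b) = ≈⇒≤ (+-congʳ a≈b)

  +-mono-≤ : ∀ {a b a′ b′} → a ≤ b → a′ ≤ b′ → a + a′ ≤ b + b′
  +-mono-≤ {a} {b} {a′} {b′} a≤b a′≤b′ = begin
    a + a′  ≤⟨ +-monoˡ-≤ a′ a≤b ⟩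
    b + a′  ≈⟨ +-comm b a′ ⟩
    a′ + b  ≤⟨ +-monoˡ-≤ b a′≤b′ ⟩
    b′ + b  ≈⟨ +-comm b′ b ⟩
    b + b′  ∎

  x≤x+y : ∀ x {y} → 0# ≤ y → x ≤ x + y
  x≤x+y x {y} 0≤y = begin
    x       ≈⟨ +-identityʳ x ⟨
    x + 0#  ≤⟨ +-mono-≤ (≈⇒≤ refl) 0≤y ⟩
    x + y   ∎

  +-cancelʳ-< : ∀ c {a b} → a + c < b + c → a < b
  +-cancelʳ-< c {a} {b} a+c<b+c = begin-strict
    a            ≈⟨ //-rightDividesʳ c a ⟨
    (a + c) - c  <⟨ +-mono-< (- c) a+c<b+c ⟩
    (b + c) - c  ≈⟨ //-rightDividesʳ c b ⟩
    b            ∎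

  +-cancelˡ-< : ∀ c {a b} → c + a < c + b → a < b
  +-cancelˡ-< c {a} {b} c+a<c+b =
    +-cancelʳ-< c (<-respʳ-≈ (+-comm c b) (<-respˡ-≈ (+-comm c a) c+a<c+b))

  x-y<z⇒x<z+y : ∀ {x y z} → x - y < z → x < z + y
  x-y<z⇒x<z+y {x} {y} x-y<z = <-respˡ-≈ (//-rightDividesˡ y x) (+-mono-< y x-y<z)

  x<z+y⇒x-y<z : ∀ {x y z} → x < z + y → x - y < z
  x<z+y⇒x-y<z {x} {y} x<z+y = <-respʳ-≈ (//-rightDividesʳ y _) (+-mono-< (- y) x<z+y)

  z<x-y⇒z+y<x : ∀ {x y z} → z < x - y → z + y < x
  z<x-y⇒z+y<x {x} {y} z<x-y = <-respʳ-≈ (//-rightDividesˡ y x) (+-mono-< y z<x-y)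

  z+y<x⇒z<x-y : ∀ {x y z} → z + y < x → z < x - y
  z+y<x⇒z<x-y {y = y} z+y<x = <-respˡ-≈ (//-rightDividesʳ y _) (+-mono-< (- y) z+y<x)

  *-monoʳ-< : ∀ {c} → 0# < c → ∀ {a b} → a < b → c * a < c * b
  *-monoʳ-< {c} 0<c {a} {b} a<b = begin-strict
    c * a                  ≈⟨ +-identityˡ (c * a) ⟨
    0# + c * a             <⟨ +-mono-< (c * a) (*-pos 0<c 0<b-a) ⟩
    c * (b - a) + c * a    ≈⟨ distribˡ c (b - a) a ⟨
    c * ((b - a) + a)      ≈⟨ *-congˡ (//-rightDividesˡ a b) ⟩
    c * b                  ∎
    where
    0<b-a : 0# < b - a
    0<b-a = <-respˡ-≈ (-‿inverseʳ a) (+-mono-< (- a) a<b)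

  *-monoʳ-≤ : ∀ {c} → 0# ≤ c → ∀ {a b} → a ≤ b → c * a ≤ c * b
  *-monoʳ-≤ (inj₁ 0<c) (inj₁ a<b) = <⇒≤ (*-monoʳ-< 0<c a<b)
  *-monoʳ-≤ {c} (inj₂ 0≈c) {a} {b} (inj₁ _) = ≈⇒≤ (begin-equality
    c * a   ≈⟨ *-congʳ 0≈c ⟨
    0# * a  ≈⟨ zeroˡ a ⟩
    0#      ≈⟨ zeroˡ b ⟨
    0# * b  ≈⟨ *-congʳ 0≈c ⟩
    c * b   ∎)
  *-monoʳ-≤ _ (inj₂ a≈b) = ≈⇒≤ (*-congˡ a≈b)

  *-monoˡ-≤ : ∀ {c} → 0# ≤ c → ∀ {a b} → a ≤ b → a * c ≤ b * c
  *-monoˡ-≤ {c} 0≤c {a} {b} a≤b = begin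
    a * c  ≈⟨ *-comm a c ⟩
    c * a  ≤⟨ *-monoʳ-≤ 0≤c a≤b ⟩
    c * b  ≈⟨ *-comm c b ⟩
    b * c  ∎

  *-nonNeg : ∀ {a b} → 0# ≤ a → 0# ≤ b → 0# ≤ a * b
  *-nonNeg {a} 0≤a 0≤b = begin
    0#      ≈⟨ zeroʳ a ⟨
    a * 0#  ≤⟨ *-monoʳ-≤ 0≤a 0≤b ⟩
    _       ∎

  *-cancelˡ-< : ∀ {c} → 0# < c → ∀ {a b} → c * a < c * b → a < b
  *-cancelˡ-< 0<c {a} {b} ca<cb with compare a b
  ... | tri< a<b _ _ = a<b
  ... | tri≈ _ a≈b _ = contradiction ca<cb (irrefl (*-congˡ a≈b))
  ... | tri> _ _ b<a = contradiction (<-trans ca<cb (*-monoʳ-< 0<c b<a)) (irrefl refl)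

  n<a∧ma≤nb⇒m<b : ∀ {m n a b} → 0# < m → 0# < n → n < a → m * a ≤ n * b → m < b
  n<a∧ma≤nb⇒m<b {m} {n} {a} {b} 0<m 0<n n<a ma≤nb = *-cancelˡ-< 0<n (begin-strict
    n * m  ≈⟨ *-comm n m ⟩
    m * n  <⟨ *-monoʳ-< 0<m n<a ⟩
    m * a  ≤⟨ ma≤nb ⟩
    n * b  ∎)

  b<m∧ma≤nb⇒a<n : ∀ {m n a b} → 0# < m → 0# < n → b < m → m * a ≤ n * b → a < n
  b<m∧ma≤nb⇒a<n {m} {n} {a} {b} 0<m 0<n b<m ma≤nb = *-cancelˡ-< 0<m (begin-strict
    m * a  ≤⟨ ma≤nb ⟩
    n * b  <⟨ *-monoʳ-< 0<n b<m ⟩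
    n * m  ≈⟨ *-comm n m ⟩
    m * n  ∎)

  fromℕ-+ : ∀ m n → fromℕ (m ℕ.+ n) ≈ fromℕ m + fromℕ n
  fromℕ-+ zero    n = sym (+-identityˡ (fromℕ n))
  fromℕ-+ (suc m) n = trans (+-congˡ (fromℕ-+ m n)) (sym (+-assoc 1# (fromℕ m) (fromℕ n)))

  fromℕ-* : ∀ m n → fromℕ (m ℕ.* n) ≈ fromℕ m * fromℕ n
  fromℕ-* zero    n = sym (zeroˡ (fromℕ n))
  fromℕ-* (suc m) n = begin-equality
    fromℕ (n ℕ.+ m ℕ.* n)             ≈⟨ fromℕ-+ n (m ℕ.* n) ⟩
    fromℕ n + fromℕ (m ℕ.* n)         ≈⟨ +-cong (sym (*-identityˡ (fromℕ n))) (fromℕ-* m n) ⟩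
    1# * fromℕ n + fromℕ m * fromℕ n  ≈⟨ distribʳ (fromℕ n) 1# (fromℕ m) ⟨
    (1# + fromℕ m) * fromℕ n          ∎

  fromℕ-nonNeg : ∀ n → 0# ≤ fromℕ n
  fromℕ-pos : ∀ n → 0# < fromℕ (suc n)
  fromℕ-nonNeg zero    = ≈⇒≤ refl
  fromℕ-nonNeg (suc n) = <⇒≤ (fromℕ-pos n)
  fromℕ-pos n = begin-strict
    0#            ≈⟨ +-identityʳ 0# ⟨
    0# + 0#       <⟨ +-mono-< 0# 0<1 ⟩
    1# + 0#       ≤⟨ +-mono-≤ (≈⇒≤ refl) (fromℕ-nonNeg n) ⟩
    1# + fromℕ n  ∎

  x<1+x : ∀ x → x < 1# + x
  x<1+x x = begin-strict
    x       ≈⟨ +-identityˡ x ⟨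
    0# + x  <⟨ +-mono-< x 0<1 ⟩
    1# + x  ∎

  fromℕ-mono-≤ : ∀ {m n} → m ℕ.≤ n → fromℕ m ≤ fromℕ n
  fromℕ-mono-≤ {m} m≤n with ℕₚ.m≤n⇒∃[o]m+o≡n m≤n
  ... | o , ≡.refl = begin
    fromℕ m            ≤⟨ x≤x+y (fromℕ m) (fromℕ-nonNeg o) ⟩
    fromℕ m + fromℕ o  ≈⟨ fromℕ-+ m o ⟨
    fromℕ (m ℕ.+ o)    ∎

  infix 4 _·_≤ₑ_·_

  -- p · A ≤ q · B in F ∪ {∞} with ∞ on top; for p = 0 it is stricter than that reading,
  -- since 0 · ∞ = 0.
  data _·_≤ₑ_·_ : ℕ → Ext → ℕ → Ext → Set (c ⊔ ℓ₁ ⊔ ℓ₂) where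
    fin≤fin : ∀ {p q a b} → fromℕ p * a ≤ fromℕ q * b → p · fin a ≤ₑ q · fin b
    ≤∞      : ∀ {p q A} → p · A ≤ₑ q · ∞

  ·≤ₑ·-⊕ : ∀ {p q A B A′ B′} → p · A ≤ₑ q · B → p · A′ ≤ₑ q · B′ → p · (A ⊕ A′) ≤ₑ q · (B ⊕ B′)
  ·≤ₑ·-⊕ {p} {q} (fin≤fin {a = a} {b} pa≤qb) (fin≤fin {a = a′} {b′} pa′≤qb′) = fin≤fin (begin
    fromℕ p * (a + a′)                ≈⟨ distribˡ (fromℕ p) a a′ ⟩
    fromℕ p * a + fromℕ p * a′        ≤⟨ +-mono-≤ pa≤qb pa′≤qb′ ⟩
    fromℕ q * b + fromℕ q * b′        ≈⟨ distribˡ (fromℕ q) b b′ ⟨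
    fromℕ q * (b + b′)                ∎)
  ·≤ₑ·-⊕ (fin≤fin _) ≤∞ = ≤∞
  ·≤ₑ·-⊕ ≤∞          _  = ≤∞

  ·≤ₑ·-⊕-nonNeg : ∀ {p q A B T} → p · A ≤ₑ q · B → NonNeg T → p · A ≤ₑ q · (B ⊕ T)
  ·≤ₑ·-⊕-nonNeg {p} {q} {T = fin t} (fin≤fin {a = a} {b} pa≤qb) 0≤t = fin≤fin (begin
    fromℕ p * a                 ≤⟨ pa≤qb ⟩
    fromℕ q * b                 ≤⟨ x≤x+y (fromℕ q * b) (*-nonNeg (fromℕ-nonNeg q) 0≤t) ⟩
    fromℕ q * b + fromℕ q * t   ≈⟨ distribˡ (fromℕ q) b t ⟨
    fromℕ q * (b + t)           ∎)
  ·≤ₑ·-⊕-nonNeg {T = ∞} (fin≤fin _) _ = ≤∞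
  ·≤ₑ·-⊕-nonNeg ≤∞                  _ = ≤∞

  ·-nonNeg : ∀ n {x} → NonNeg x → NonNeg (n · x)
  ·-nonNeg n       {fin y} 0≤y = *-nonNeg (fromℕ-nonNeg n) 0≤y
  ·-nonNeg zero    {∞}     _   = ≈⇒≤ refl
  ·-nonNeg (suc _) {∞}     _   = tt

  ·≤ₑ·-· : ∀ {p q m n} → suc p ℕ.* m ℕ.≤ q ℕ.* n → ∀ {x} → NonNeg x → suc p · (m · x) ≤ₑ q · (n · x)
  ·≤ₑ·-· {p} {q} {m} {n} pm≤qn {fin y} 0≤y = fin≤fin (begin
    fromℕ (suc p) * (fromℕ m * y)  ≈⟨ *-assoc (fromℕ (suc p)) (fromℕ m) y ⟨
    fromℕ (suc p) * fromℕ m * y    ≈⟨ *-congʳ (fromℕ-* (suc p) m) ⟨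
    fromℕ (suc p ℕ.* m) * y        ≤⟨ *-monoˡ-≤ 0≤y (fromℕ-mono-≤ pm≤qn) ⟩
    fromℕ (q ℕ.* n) * y            ≈⟨ *-congʳ (fromℕ-* q n) ⟩
    fromℕ q * fromℕ n * y          ≈⟨ *-assoc (fromℕ q) (fromℕ n) y ⟩
    fromℕ q * (fromℕ n * y)        ∎)
  ·≤ₑ·-· {n = suc _}                 _     {∞} _ = ≤∞
  ·≤ₑ·-· {m = zero}  {zero}          _     {∞} _ = fin≤fin (≈⇒≤ (trans (zeroʳ _) (sym (zeroʳ _))))
  ·≤ₑ·-· {q = q} {m = suc _} {zero}  pm≤q0 {∞} _ =
    contradiction (ℕₚ.≤-trans pm≤q0 (ℕₚ.≤-reflexive (ℕₚ.*-zeroʳ q))) λ ()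

  module _ (α : ℕ → Ext) (α-nonNeg : ∀ i → NonNeg (α (suc i))) where

    dotAux-≤ₑ : ∀ {p q s s′} → (∀ j → suc p ℕ.* (s C (2 ℕ.+ j)) ℕ.≤ q ℕ.* (s′ C (2 ℕ.+ j))) →
                ∀ k → suc p · dotAux α s k ≤ₑ q · dotAux α s′ k
    dotAux-≤ₑ _     zero    = fin≤fin (≈⇒≤ (trans (zeroʳ _) (sym (zeroʳ _))))
    dotAux-≤ₑ C-≤ (suc k) = ·≤ₑ·-⊕ (dotAux-≤ₑ C-≤ k) (·≤ₑ·-· (C-≤ k) (α-nonNeg k))

    dot-≤ₑ : ∀ t → suc (suc t) · dot α (suc t) ≤ₑ t · dot α (suc (suc t))
    dot-≤ₑ t = ·≤ₑ·-⊕-nonNeg (dotAux-≤ₑ ([2+t]*[1+t]C[2+j]≤t*[2+t]C[2+j] t) t)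
                             (·-nonNeg (suc (suc t) C suc (suc t)) (α-nonNeg t))

    gap<1⇒gap-suc<0 : ∀ s → 2 ℕ.≤ s → fromℕ s − dot α s <ₑ 1# → fromℕ (suc s) − dot α (suc s) <ₑ 0#
    gap<1⇒gap-suc<0 (suc (suc t)) (ℕ.s≤s (ℕ.s≤s ℕ.z≤n)) gap<1
      with dot α (suc (suc t)) | dot α (suc (suc (suc t))) | dot-≤ₑ (suc t)
    ... | _     | ∞     | _             = tt
    ... | fin a | fin b | fin≤fin ma≤nb = x<z+y⇒x-y<z (<-respʳ-≈ (sym (+-identityˡ b)) m<b)
      where
      n<a : fromℕ (suc t) < a
      n<a = +-cancelˡ-< 1# (x-y<z⇒x<z+y gap<1)
      m<b : fromℕ (suc (suc (suc t))) < b
      m<b = n<a∧ma≤nb⇒m<b (fromℕ-pos (suc (suc t))) (fromℕ-pos t) n<a ma≤nb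

    gap>1⇒gap-pred>1 : ∀ s → 3 ℕ.≤ s → fromℕ s − dot α s >ₑ 1# → fromℕ (s ∸ 1) − dot α (s ∸ 1) >ₑ 1#
    gap>1⇒gap-pred>1 (suc (suc (suc t))) (ℕ.s≤s (ℕ.s≤s (ℕ.s≤s ℕ.z≤n))) gap>1
      -- no ∞ cases: dot α (3+t) = ∞ makes gap>1 absurd, and then dot-≤ₑ excludes dot α (2+t) = ∞
      with dot α (suc (suc t)) | dot α (suc (suc (suc t))) | dot-≤ₑ (suc t)
    ... | fin a | fin b | fin≤fin ma≤nb = z+y<x⇒z<x-y (+-monoʳ-< 1# a<n)
      where
      b<m : b < fromℕ (suc (suc (suc t)))
      b<m = <-trans (+-cancelˡ-< 1# (z<x-y⇒z+y<x gap>1)) (x<1+x (fromℕ (suc (suc t))))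
      a<n : a < fromℕ (suc t)
      a<n = b<m∧ma≤nb⇒a<n (fromℕ-pos (suc (suc t))) (fromℕ-pos t) b<m ma≤nb

open import Data.Nat using (_≤_)

lemma2p1 : ∀ {c ℓ₁ ℓ₂} (F : OrderedField c ℓ₁ ℓ₂) →
    let open WithField F in
    (α : ℕ → Ext) → (∀ i → NonNeg (α (suc i))) →
    ((s : ℕ) → 2 ≤ s → fromℕ s − dot α s <ₑ 1# → fromℕ (suc s) − dot α (suc s) <ₑ 0#)
    × ((s : ℕ) → 3 ≤ s → fromℕ s − dot α s >ₑ 1# → fromℕ (s ∸ 1) − dot α (s ∸ 1) >ₑ 1#)
lemma2p1 F α α-nonNeg = gap<1⇒gap-suc<0 F α α-nonNeg , gap>1⇒gap-pred>1 F α α-nonNeg
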